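{- For every rational plane $L\in\mathrm{Gr}(\mathbb Q)$, the pair of associated integer points $(a_1(L),a_2(L))$ is pair-primitive, and $a_1(L)\equiv a_2(L)\bmod 2$.
   Context: $\mathbf D$ is the Hamiltonian quaternion algebra over $\mathbb Q$ with basis $1,\mathrm i,\mathrm j,\mathrm k$, conjugation $\overline x$, trace $\mathrm{Tr}(x)=x+\overline x$; identify $\mathbb R^4\cong\mathbf D(\mathbb R)$ and pure quaternions $\cong\mathbb R^3$. For a rational 2-dimensional plane $L\subset\mathbb R^4$ with $\mathbb Z$-basis $v_1,v_2$ of $L(\mathbb Z)=L\cap\mathbb Z^4$: $a_1(L)=v_1\overline{v_2}-\tfrac12\mathrm{Tr}(v_1\overline{v_2})$, $a_2(L)=\overline{v_2}v_1-\tfrac12\mathrm{Tr}(\overline{v_2}v_1)\in\mathbb Z^3$. A pair $(w_1,w_2)\in\mathbb Z^3\times\mathbb Z^3$ is pair-primitive if for every odd prime $p$, $\tfrac1pw_1\notin\mathbb Z^3$ or $\tfrac1pw_2\notin\mathbb Z^3$, and if $\tfrac14(w_1+w_2)\notin\mathbb Z^3$ or $\tfrac14(w_1-w_2)\notin\mathbb Z^3$. -}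

module Defs where

open import Data.Nat using (ℕ)
import Data.Nat.Divisibility as ℕD
open import Data.Nat.Primality using (Prime)
open import Data.Integer using (ℤ; +_; _+_; _-_; _*_; -_)
open import Data.Integer.Divisibility using (_∣_)
open import Data.Product using (_×_; Σ; ∃; ∃-syntax)
open import Data.Sum using (_⊎_)
open import Relation.Nullary using (¬_)
open import Relation.Binary.PropositionalEquality using (_≡_; _≢_)

record Quat : Set where
  constructor quat
  field
    re i j k : ℤ
open Quat public

-- ℤ³ ≅ pure quaternions with integer coordinates (coefficients of i, j, k)
record Z3 : Set where
  constructor z3
  field
    x y z : ℤ
open Z3 public

_·_ : Quat → Quat → Quat
quat a1 b1 c1 d1 · quat a2 b2 c2 d2 =
  quat (a1 * a2 - b1 * b2 - c1 * c2 - d1 * d2)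
       (a1 * b2 + b1 * a2 + c1 * d2 - d1 * c2)
       (a1 * c2 - b1 * d2 + c1 * a2 + d1 * b2)
       (a1 * d2 + b1 * c2 - c1 * b2 + d1 * a2)

conj : Quat → Quat
conj (quat a b c d) = quat a (- b) (- c) (- d)

-- x - ½ Tr(x): since Tr(x) = x + conj x = 2·re x, this is the pure part of x,
-- i.e. the quaternion (0, i x, j x, k x), recorded as a point of ℤ³.
pure : Quat → Z3
pure q = z3 (i q) (j q) (k q)

-- a₁(L) = v₁ conj(v₂) - ½Tr(v₁ conj(v₂)),  a₂(L) = conj(v₂) v₁ - ½Tr(conj(v₂) v₁)
a₁ : Quat → Quat → Z3
a₁ v₁ v₂ = pure (v₁ · conj v₂)

a₂ : Quat → Quat → Z3
a₂ v₁ v₂ = pure (conj v₂ · v₁)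

_⊙_ : ℤ → Quat → Quat
n ⊙ quat a b c d = quat (n * a) (n * b) (n * c) (n * d)

_⊕_ : Quat → Quat → Quat
quat a1 b1 c1 d1 ⊕ quat a2 b2 c2 d2 = quat (a1 + a2) (b1 + b2) (c1 + c2) (d1 + d2)

zeroQ : Quat
zeroQ = quat (+ 0) (+ 0) (+ 0) (+ 0)

-- v₁, v₂ are linearly independent (over ℤ, equivalently over ℚ)
LinIndep : Quat → Quat → Set
LinIndep v₁ v₂ = ∀ (a b : ℤ) → (a ⊙ v₁) ⊕ (b ⊙ v₂) ≡ zeroQ → (a ≡ + 0) × (b ≡ + 0)

-- For L = ℚ-span of v₁, v₂ (a rational plane when v₁, v₂ are independent):
-- every w ∈ L(ℤ) = L ∩ ℤ⁴ is a ℤ-combination of v₁, v₂.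
-- An integer vector w lies in L iff n·w = a·v₁ + b·v₂ for some integers n ≠ 0, a, b.
SpansLZ : Quat → Quat → Set
SpansLZ v₁ v₂ = ∀ (w : Quat) (n a b : ℤ) → n ≢ + 0 →
  n ⊙ w ≡ (a ⊙ v₁) ⊕ (b ⊙ v₂) →
  ∃[ c ] ∃[ d ] w ≡ (c ⊙ v₁) ⊕ (d ⊙ v₂)

IsBasisOfPlaneLattice : Quat → Quat → Set
IsBasisOfPlaneLattice v₁ v₂ = LinIndep v₁ v₂ × SpansLZ v₁ v₂

_∣³_ : ℤ → Z3 → Set
n ∣³ w = (n ∣ x w) × (n ∣ y w) × (n ∣ z w)

_+³_ : Z3 → Z3 → Z3
w₁ +³ w₂ = z3 (x w₁ + x w₂) (y w₁ + y w₂) (z w₁ + z w₂)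

_-³_ : Z3 → Z3 → Z3
w₁ -³ w₂ = z3 (x w₁ - x w₂) (y w₁ - y w₂) (z w₁ - z w₂)

PairPrimitive : Z3 → Z3 → Set
PairPrimitive w₁ w₂ =
  (∀ (p : ℕ) → Prime p → ¬ (2 ℕD.∣ p) →
     (¬ ((+ p) ∣³ w₁)) ⊎ (¬ ((+ p) ∣³ w₂)))
  × ((¬ ((+ 4) ∣³ (w₁ +³ w₂))) ⊎ (¬ ((+ 4) ∣³ (w₁ -³ w₂))))

_≡₂_ : Z3 → Z3 → Set
w₁ ≡₂ w₂ = (+ 2) ∣³ (w₁ -³ w₂)

-- Write v₁ = (x₀, x₁, x₂, x₃), v₂ = (y₀, y₁, y₂, y₃) and let p_rs = x_r y_s − x_s y_r be the
-- Plücker coordinates of v₁ ∧ v₂. Expanding the quaternion products gives a₁ = s + t and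
-- a₂ = s − t, where s = (p₁₀, p₂₀, p₃₀) and t = (p₃₂, p₁₃, p₂₁) are the self-dual and
-- anti-self-dual halves of v₁ ∧ v₂. So a₁ − a₂ = 2t, and an odd prime dividing a₁ and a₂,
-- or 4 dividing a₁ + a₂ and a₁ − a₂, gives some m ≠ ±1 dividing every p_rs. That is
-- impossible for a basis of L(ℤ): the vector y_r v₁ − x_r v₂ has coordinates p_sr, so it lies
-- in m·L(ℤ), which forces m ∣ x_r; then v₁ / m ∈ L(ℤ), contradicting that v₁ is a basis vector.

module Submission where

open import Defs
open import Data.Fin using (Fin)
open import Data.Fin.Patterns using (0F; 1F; 2F; 3F)
import Data.Nat.Coprimality as ℕC
import Data.Nat.Divisibility as ℕD
open import Data.Nat.Primality using (Prime; ¬prime[0]; ¬prime[1]; irreducible[2])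
open import Data.Integer using (ℤ; +_; _+_; _-_; _*_; -_; ∣_∣; NonZero)
open import Data.Integer.Properties using (∣-i∣≡∣i∣; *-comm; +-inverseʳ; i-j≡0⇒i≡j)
open import Data.Integer.Coprimality using (Coprime; coprime-divisor)
open import Data.Integer.Divisibility using (_∣_; *-cancelˡ-∣)
import Data.Integer.Divisibility.Signed as Signed
open import Data.Integer.Tactic.RingSolver using (solve-∀)
open import Data.Product using (_×_; _,_; proj₁; proj₂; ∃-syntax)
open import Data.Sum using (_⊎_; inj₁; inj₂)
open import Relation.Nullary using (¬_; Dec; yes; no; _×-dec_; contradiction)
open import Relation.Binary.PropositionalEquality
  using (_≡_; _≢_; refl; sym; trans; cong; cong₂; subst; module ≡-Reasoning)

¬×⇒¬⊎¬ : ∀ {a b} {A : Set a} {B : Set b} → Dec A → ¬ (A × B) → ¬ A ⊎ ¬ B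
¬×⇒¬⊎¬ (yes a) ¬a×b = inj₂ (λ b → ¬a×b (a , b))
¬×⇒¬⊎¬ (no ¬a) _    = inj₁ ¬a

∣-m⇒∣m : ∀ {k m} → k ∣ - m → k ∣ m
∣-m⇒∣m {k} {m} = subst (∣ k ∣ ℕD.∣_) (∣-i∣≡∣i∣ m)

∣m⇒∣-m : ∀ {k m} → k ∣ m → k ∣ - m
∣m⇒∣-m {k} {m} = subst (∣ k ∣ ℕD.∣_) (sym (∣-i∣≡∣i∣ m))

∣0 : ∀ {k} → k ∣ + 0
∣0 {k} = ∣ k ∣ ℕD.∣0

∣m∣n⇒∣m+n : ∀ {k} m n → k ∣ m → k ∣ n → k ∣ m + n
∣m∣n⇒∣m+n {k} m n k∣m k∣n =
  Signed.∣⇒∣ᵤ (Signed.∣m∣n⇒∣m+n (Signed.∣ᵤ⇒∣ {k} {m} k∣m) (Signed.∣ᵤ⇒∣ {k} {n} k∣n))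

∣m∣n⇒∣m-n : ∀ {k} m n → k ∣ m → k ∣ n → k ∣ m - n
∣m∣n⇒∣m-n {k} m n k∣m k∣n =
  Signed.∣⇒∣ᵤ (Signed.∣m∣n⇒∣m-n (Signed.∣ᵤ⇒∣ {k} {m} k∣m) (Signed.∣ᵤ⇒∣ {k} {n} k∣n))

m-k*q≡0⇒k∣m : ∀ {k m} q → m - k * q ≡ + 0 → k ∣ m
m-k*q≡0⇒k∣m {k} {m} q eq =
  Signed.∣⇒∣ᵤ (Signed.divides q (trans (i-j≡0⇒i≡j m (k * q) eq) (*-comm k q)))

_·³_ : ℤ → Z3 → Z3
n ·³ w = z3 (n * x w) (n * y w) (n * z w)

_∣³?_ : ∀ n w → Dec (n ∣³ w)
n ∣³? w = (∣ n ∣ ℕD.∣? ∣ x w ∣) ×-dec (∣ n ∣ ℕD.∣? ∣ y w ∣) ×-dec (∣ n ∣ ℕD.∣? ∣ z w ∣)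

∣³-+³ : ∀ {n} u w → n ∣³ u → n ∣³ w → n ∣³ (u +³ w)
∣³-+³ {n} u w (u₁ , u₂ , u₃) (w₁ , w₂ , w₃) =
  ∣m∣n⇒∣m+n {n} (x u) (x w) u₁ w₁ , ∣m∣n⇒∣m+n {n} (y u) (y w) u₂ w₂ , ∣m∣n⇒∣m+n {n} (z u) (z w) u₃ w₃

∣³--³ : ∀ {n} u w → n ∣³ u → n ∣³ w → n ∣³ (u -³ w)
∣³--³ {n} u w (u₁ , u₂ , u₃) (w₁ , w₂ , w₃) =
  ∣m∣n⇒∣m-n {n} (x u) (x w) u₁ w₁ , ∣m∣n⇒∣m-n {n} (y u) (y w) u₂ w₂ , ∣m∣n⇒∣m-n {n} (z u) (z w) u₃ w₃

cong-z3 : ∀ {a b c a′ b′ c′ : ℤ} → a ≡ a′ → b ≡ b′ → c ≡ c′ → z3 a b c ≡ z3 a′ b′ c′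
cong-z3 refl refl refl = refl

n∣³n·³w : ∀ n w → n ∣³ (n ·³ w)
n∣³n·³w n w = n∣n*m (x w) , n∣n*m (y w) , n∣n*m (z w)
  where
  n∣n*m : ∀ m → n ∣ n * m
  n∣n*m m = Signed.∣⇒∣ᵤ {n} {n * m} (Signed.∣m⇒∣m*n m Signed.∣-refl)

coprime-divisor³ : ∀ n k w → Coprime n k → n ∣³ (k ·³ w) → n ∣³ w
coprime-divisor³ n k w n⊥k (n∣x , n∣y , n∣z) =
  coprime-divisor n k (x w) n⊥k n∣x ,
  coprime-divisor n k (y w) n⊥k n∣y ,
  coprime-divisor n k (z w) n⊥k n∣z

*-cancelˡ-∣³ : ∀ k {n w} .{{_ : NonZero k}} → (k * n) ∣³ (k ·³ w) → n ∣³ w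
*-cancelˡ-∣³ k (kn∣x , kn∣y , kn∣z) = *-cancelˡ-∣ k kn∣x , *-cancelˡ-∣ k kn∣y , *-cancelˡ-∣ k kn∣z

+³-+³--³ : ∀ u w → (u +³ w) +³ (u -³ w) ≡ (+ 2) ·³ u
+³-+³--³ (z3 u₁ u₂ u₃) (z3 w₁ w₂ w₃) = cong-z3 (sum u₁ w₁) (sum u₂ w₂) (sum u₃ w₃)
  where
  sum : ∀ a b → (a + b) + (a - b) ≡ + 2 * a
  sum = solve-∀

+³--³--³ : ∀ u w → (u +³ w) -³ (u -³ w) ≡ (+ 2) ·³ w
+³--³--³ (z3 u₁ u₂ u₃) (z3 w₁ w₂ w₃) = cong-z3 (dif u₁ w₁) (dif u₂ w₂) (dif u₃ w₃)
  where
  dif : ∀ a b → (a + b) - (a - b) ≡ + 2 * b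
  dif = solve-∀

odd-prime⇒coprime-2 : ∀ {p} → Prime p → ¬ (2 ℕD.∣ p) → ℕC.Coprime p 2
odd-prime⇒coprime-2 _ 2∤p (d∣p , d∣2) with irreducible[2] d∣2
... | inj₁ d≡1 = d≡1
... | inj₂ refl = contradiction d∣p 2∤p

coord : Fin 4 → Quat → ℤ
coord 0F = re
coord 1F = i
coord 2F = j
coord 3F = k

fromCoords : (Fin 4 → ℤ) → Quat
fromCoords f = quat (f 0F) (f 1F) (f 2F) (f 3F)

coord-fromCoords : ∀ r f → coord r (fromCoords f) ≡ f r
coord-fromCoords 0F f = refl
coord-fromCoords 1F f = refl
coord-fromCoords 2F f = refl
coord-fromCoords 3F f = refl

coord-⊙ : ∀ r n q → coord r (n ⊙ q) ≡ n * coord r q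
coord-⊙ 0F n q = refl
coord-⊙ 1F n q = refl
coord-⊙ 2F n q = refl
coord-⊙ 3F n q = refl

coord-⊕ : ∀ r u w → coord r (u ⊕ w) ≡ coord r u + coord r w
coord-⊕ 0F u w = refl
coord-⊕ 1F u w = refl
coord-⊕ 2F u w = refl
coord-⊕ 3F u w = refl

coord-zeroQ : ∀ r → coord r zeroQ ≡ + 0
coord-zeroQ 0F = refl
coord-zeroQ 1F = refl
coord-zeroQ 2F = refl
coord-zeroQ 3F = refl

coord-injective : ∀ {u w} → (∀ r → coord r u ≡ coord r w) → u ≡ w
coord-injective {quat _ _ _ _} {quat _ _ _ _} eq
  with refl ← eq 0F | refl ← eq 1F | refl ← eq 2F | refl ← eq 3F = refl

coord-⊙⊕ : ∀ r s t u w → coord r ((s ⊙ u) ⊕ (t ⊙ w)) ≡ s * coord r u + t * coord r w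
coord-⊙⊕ r s t u w = trans (coord-⊕ r (s ⊙ u) (t ⊙ w)) (cong₂ _+_ (coord-⊙ r s u) (coord-⊙ r t w))

_∣⁴_ : ℤ → Quat → Set
m ∣⁴ w = ∀ r → m ∣ coord r w

∣⁴⇒∃⊙ : ∀ {m w} → m ∣⁴ w → ∃[ q ] m ⊙ q ≡ w
∣⁴⇒∃⊙ {m} {w} m∣w = fromCoords quotient , coord-injective λ r → begin
  coord r (m ⊙ fromCoords quotient)  ≡⟨ coord-⊙ r m _ ⟩
  m * coord r (fromCoords quotient)  ≡⟨ cong (m *_) (coord-fromCoords r quotient) ⟩
  m * quotient r                     ≡⟨ *-comm m (quotient r) ⟩
  quotient r * m                     ≡⟨ sym (Signed._∣_.equality (m∣w′ r)) ⟩
  coord r w                          ∎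
  where
  open ≡-Reasoning
  m∣w′ : ∀ r → m Signed.∣ coord r w
  m∣w′ r = Signed.∣ᵤ⇒∣ {m} {coord r w} (m∣w r)
  quotient : Fin 4 → ℤ
  quotient r = Signed.quotient (m∣w′ r)

lincomb-cancel : ∀ {m c d s t} u w → m ⊙ ((c ⊙ u) ⊕ (d ⊙ w)) ≡ (s ⊙ u) ⊕ (t ⊙ w) →
                 ((s - m * c) ⊙ u) ⊕ ((t - m * d) ⊙ w) ≡ zeroQ
lincomb-cancel {m} {c} {d} {s} {t} u w eq = coord-injective λ r → begin
  coord r (((s - m * c) ⊙ u) ⊕ ((t - m * d) ⊙ w))  ≡⟨ coord-⊙⊕ r (s - m * c) (t - m * d) u w ⟩
  (s - m * c) * coord r u + (t - m * d) * coord r w  ≡⟨ regroup s t m c d (coord r u) (coord r w) ⟩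
  (s * coord r u + t * coord r w) - m * (c * coord r u + d * coord r w)
    ≡⟨ cong₂ _-_ (sym (coord-⊙⊕ r s t u w)) (sym (coord-m⊙ r)) ⟩
  coord r ((s ⊙ u) ⊕ (t ⊙ w)) - coord r (m ⊙ ((c ⊙ u) ⊕ (d ⊙ w)))
    ≡⟨ cong (λ v → coord r v - coord r (m ⊙ ((c ⊙ u) ⊕ (d ⊙ w)))) (sym eq) ⟩
  coord r (m ⊙ ((c ⊙ u) ⊕ (d ⊙ w))) - coord r (m ⊙ ((c ⊙ u) ⊕ (d ⊙ w)))
    ≡⟨ +-inverseʳ (coord r (m ⊙ ((c ⊙ u) ⊕ (d ⊙ w)))) ⟩
  + 0                                                 ≡⟨ sym (coord-zeroQ r) ⟩
  coord r zeroQ                                       ∎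
  where
  open ≡-Reasoning
  regroup : ∀ s t m c d a b → (s - m * c) * a + (t - m * d) * b ≡ (s * a + t * b) - m * (c * a + d * b)
  regroup = solve-∀
  coord-m⊙ : ∀ r → coord r (m ⊙ ((c ⊙ u) ⊕ (d ⊙ w))) ≡ m * (c * coord r u + d * coord r w)
  coord-m⊙ r = trans (coord-⊙ r m _) (cong (m *_) (coord-⊙⊕ r c d u w))

∣⁴-combination⇒∣coefficients : ∀ {v₁ v₂ m s t} → IsBasisOfPlaneLattice v₁ v₂ → m ≢ + 0 →
                                m ∣⁴ ((s ⊙ v₁) ⊕ (t ⊙ v₂)) → (m ∣ s) × (m ∣ t)
∣⁴-combination⇒∣coefficients {v₁} {v₂} {m} {s} {t} (independent , spanning) m≢0 m∣w
  with q , m⊙q≡w ← ∣⁴⇒∃⊙ {m} {(s ⊙ v₁) ⊕ (t ⊙ v₂)} m∣w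
  with c , d , refl ← spanning q m s t m≢0 m⊙q≡w
  with s-mc≡0 , t-md≡0 ← independent (s - m * c) (t - m * d)
                              (lincomb-cancel {m} {c} {d} {s} {t} v₁ v₂ m⊙q≡w)
  = m-k*q≡0⇒k∣m {m} {s} c s-mc≡0 , m-k*q≡0⇒k∣m {m} {t} d t-md≡0

plücker : Fin 4 → Fin 4 → Quat → Quat → ℤ
plücker r s v₁ v₂ = coord r v₁ * coord s v₂ - coord s v₁ * coord r v₂

plücker-antisym : ∀ r s v₁ v₂ → plücker r s v₁ v₂ ≡ - plücker s r v₁ v₂
plücker-antisym r s v₁ v₂ = antisym (coord r v₁) (coord r v₂) (coord s v₁) (coord s v₂)
  where
  antisym : ∀ a b c d → a * d - c * b ≡ - (c * b - a * d)
  antisym = solve-∀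

plücker-diag : ∀ r v₁ v₂ → plücker r r v₁ v₂ ≡ + 0
plücker-diag r v₁ v₂ = +-inverseʳ (coord r v₁ * coord r v₂)

coord-combination : ∀ r s v₁ v₂ →
  coord s ((coord r v₂ ⊙ v₁) ⊕ ((- coord r v₁) ⊙ v₂)) ≡ plücker s r v₁ v₂
coord-combination r s v₁ v₂ =
  trans (coord-⊙⊕ s (coord r v₂) (- coord r v₁) v₁ v₂)
        (rearrange (coord r v₁) (coord r v₂) (coord s v₁) (coord s v₂))
  where
  rearrange : ∀ a b c d → b * c + - a * d ≡ c * b - a * d
  rearrange = solve-∀

∣plücker⇒∣coord : ∀ {v₁ v₂ m} → IsBasisOfPlaneLattice v₁ v₂ → m ≢ + 0 →
                   (∀ r s → m ∣ plücker r s v₁ v₂) → ∀ r → m ∣ coord r v₁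
∣plücker⇒∣coord {v₁} {v₂} {m} basis m≢0 m∣p r =
  ∣-m⇒∣m {m} {coord r v₁}
    (proj₂ (∣⁴-combination⇒∣coefficients {v₁} {v₂} {m} {coord r v₂} {t = - coord r v₁}
                                          basis m≢0 m∣combination))
  where
  m∣combination : m ∣⁴ ((coord r v₂ ⊙ v₁) ⊕ ((- coord r v₁) ⊙ v₂))
  m∣combination s = subst (m ∣_) (sym (coord-combination r s v₁ v₂)) (m∣p s r)

∣plücker⇒∣1 : ∀ {v₁ v₂ m} → IsBasisOfPlaneLattice v₁ v₂ → m ≢ + 0 →
              (∀ r s → m ∣ plücker r s v₁ v₂) → m ∣ + 1
∣plücker⇒∣1 {v₁} {v₂} {m} basis m≢0 m∣p =
  proj₁ (∣⁴-combination⇒∣coefficients {v₁} {v₂} {m} {+ 1} {+ 0} basis m≢0 m∣v₁)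
  where
  coord-v₁ : ∀ r → coord r (((+ 1) ⊙ v₁) ⊕ ((+ 0) ⊙ v₂)) ≡ coord r v₁
  coord-v₁ r = trans (coord-⊙⊕ r (+ 1) (+ 0) v₁ v₂) (one-zero (coord r v₁) (coord r v₂))
    where
    one-zero : ∀ a b → + 1 * a + + 0 * b ≡ a
    one-zero = solve-∀
  m∣v₁ : m ∣⁴ (((+ 1) ⊙ v₁) ⊕ ((+ 0) ⊙ v₂))
  m∣v₁ r = subst (m ∣_) (sym (coord-v₁ r)) (∣plücker⇒∣coord basis m≢0 m∣p r)

selfDual antiSelfDual : Quat → Quat → Z3
selfDual     v₁ v₂ = z3 (plücker 1F 0F v₁ v₂) (plücker 2F 0F v₁ v₂) (plücker 3F 0F v₁ v₂)
antiSelfDual v₁ v₂ = z3 (plücker 3F 2F v₁ v₂) (plücker 1F 3F v₁ v₂) (plücker 2F 1F v₁ v₂)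

∣dual-parts⇒∣plücker : ∀ {v₁ v₂ m} → m ∣³ selfDual v₁ v₂ → m ∣³ antiSelfDual v₁ v₂ →
                        ∀ r s → m ∣ plücker r s v₁ v₂
∣dual-parts⇒∣plücker {v₁} {v₂} {m} (m∣p₁₀ , m∣p₂₀ , m∣p₃₀) (m∣p₃₂ , m∣p₁₃ , m∣p₂₁) = table
  where
  swap : ∀ r s → m ∣ plücker s r v₁ v₂ → m ∣ plücker r s v₁ v₂
  swap r s m∣p = subst (m ∣_) (sym (plücker-antisym r s v₁ v₂)) (∣m⇒∣-m {m} {plücker s r v₁ v₂} m∣p)
  diag : ∀ r → m ∣ plücker r r v₁ v₂
  diag r = subst (m ∣_) (sym (plücker-diag r v₁ v₂)) (∣0 {m})
  table : ∀ r s → m ∣ plücker r s v₁ v₂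
  table 0F 0F = diag 0F
  table 0F 1F = swap 0F 1F m∣p₁₀
  table 0F 2F = swap 0F 2F m∣p₂₀
  table 0F 3F = swap 0F 3F m∣p₃₀
  table 1F 0F = m∣p₁₀
  table 1F 1F = diag 1F
  table 1F 2F = swap 1F 2F m∣p₂₁
  table 1F 3F = m∣p₁₃
  table 2F 0F = m∣p₂₀
  table 2F 1F = m∣p₂₁
  table 2F 2F = diag 2F
  table 2F 3F = swap 2F 3F m∣p₃₂
  table 3F 0F = m∣p₃₀
  table 3F 1F = swap 3F 1F m∣p₁₃
  table 3F 2F = m∣p₃₂
  table 3F 3F = diag 3F

a₁≡selfDual+antiSelfDual : ∀ v₁ v₂ → a₁ v₁ v₂ ≡ selfDual v₁ v₂ +³ antiSelfDual v₁ v₂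
a₁≡selfDual+antiSelfDual (quat a b c d) (quat e f g h) =
  cong-z3 (i-part a b c d e f g h) (j-part a b c d e f g h) (k-part a b c d e f g h)
  where
  i-part : ∀ a b c d e f g h → a * - f + b * e + c * - h - d * - g ≡ (b * e - a * f) + (d * g - c * h)
  i-part = solve-∀
  j-part : ∀ a b c d e f g h → a * - g - b * - h + c * e + d * - f ≡ (c * e - a * g) + (b * h - d * f)
  j-part = solve-∀
  k-part : ∀ a b c d e f g h → a * - h + b * - g - c * - f + d * e ≡ (d * e - a * h) + (c * f - b * g)
  k-part = solve-∀

a₂≡selfDual-antiSelfDual : ∀ v₁ v₂ → a₂ v₁ v₂ ≡ selfDual v₁ v₂ -³ antiSelfDual v₁ v₂
a₂≡selfDual-antiSelfDual (quat a b c d) (quat e f g h) =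
  cong-z3 (i-part a b c d e f g h) (j-part a b c d e f g h) (k-part a b c d e f g h)
  where
  i-part : ∀ a b c d e f g h → e * b + - f * a + - g * d - - h * c ≡ (b * e - a * f) - (d * g - c * h)
  i-part = solve-∀
  j-part : ∀ a b c d e f g h → e * c - - f * d + - g * a + - h * b ≡ (c * e - a * g) - (b * h - d * f)
  j-part = solve-∀
  k-part : ∀ a b c d e f g h → e * d + - f * c - - g * b + - h * a ≡ (d * e - a * h) - (c * f - b * g)
  k-part = solve-∀

a₁+a₂≡2·selfDual : ∀ v₁ v₂ → a₁ v₁ v₂ +³ a₂ v₁ v₂ ≡ (+ 2) ·³ selfDual v₁ v₂
a₁+a₂≡2·selfDual v₁ v₂ =
  trans (cong₂ _+³_ (a₁≡selfDual+antiSelfDual v₁ v₂) (a₂≡selfDual-antiSelfDual v₁ v₂))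
        (+³-+³--³ (selfDual v₁ v₂) (antiSelfDual v₁ v₂))

a₁-a₂≡2·antiSelfDual : ∀ v₁ v₂ → a₁ v₁ v₂ -³ a₂ v₁ v₂ ≡ (+ 2) ·³ antiSelfDual v₁ v₂
a₁-a₂≡2·antiSelfDual v₁ v₂ =
  trans (cong₂ _-³_ (a₁≡selfDual+antiSelfDual v₁ v₂) (a₂≡selfDual-antiSelfDual v₁ v₂))
        (+³--³--³ (selfDual v₁ v₂) (antiSelfDual v₁ v₂))

∣dual-parts⇒∣1 : ∀ {v₁ v₂ m} → IsBasisOfPlaneLattice v₁ v₂ → m ≢ + 0 →
                 m ∣³ selfDual v₁ v₂ → m ∣³ antiSelfDual v₁ v₂ → m ∣ + 1
∣dual-parts⇒∣1 {v₁} {v₂} {m} basis m≢0 m∣s m∣t =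
  ∣plücker⇒∣1 basis m≢0 (∣dual-parts⇒∣plücker {v₁} {v₂} {m} m∣s m∣t)

lemma2p3 : ∀ (v₁ v₂ : Quat) → IsBasisOfPlaneLattice v₁ v₂ →
    PairPrimitive (a₁ v₁ v₂) (a₂ v₁ v₂) × (a₁ v₁ v₂ ≡₂ a₂ v₁ v₂)
lemma2p3 v₁ v₂ basis = (odd-prime-case , four-case) , a₁≡₂a₂
  where
  A₁ A₂ : Z3
  A₁ = a₁ v₁ v₂
  A₂ = a₂ v₁ v₂
  odd-prime-case : ∀ p → Prime p → ¬ (2 ℕD.∣ p) → ¬ ((+ p) ∣³ A₁) ⊎ ¬ ((+ p) ∣³ A₂)
  odd-prime-case p p-prime p-odd = ¬×⇒¬⊎¬ ((+ p) ∣³? A₁) λ (p∣A₁ , p∣A₂) →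
    ¬prime[1] (subst Prime (ℕD.∣1⇒≡1 (∣dual-parts⇒∣1 {v₁} {v₂} {+ p} basis p≢0
      (halve (a₁+a₂≡2·selfDual v₁ v₂) (∣³-+³ {+ p} A₁ A₂ p∣A₁ p∣A₂))
      (halve (a₁-a₂≡2·antiSelfDual v₁ v₂) (∣³--³ {+ p} A₁ A₂ p∣A₁ p∣A₂)))) p-prime)
    where
    p≢0 : + p ≢ + 0
    p≢0 refl = ¬prime[0] p-prime
    halve : ∀ {u w} → u ≡ (+ 2) ·³ w → (+ p) ∣³ u → (+ p) ∣³ w
    halve {w = w} refl = coprime-divisor³ (+ p) (+ 2) w (odd-prime⇒coprime-2 p-prime p-odd)
  four-case : ¬ ((+ 4) ∣³ (A₁ +³ A₂)) ⊎ ¬ ((+ 4) ∣³ (A₁ -³ A₂))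
  four-case = ¬×⇒¬⊎¬ ((+ 4) ∣³? (A₁ +³ A₂)) λ (4∣sum , 4∣difference) →
    2∤1 (∣dual-parts⇒∣1 {v₁} {v₂} {+ 2} basis (λ ())
      (halve (a₁+a₂≡2·selfDual v₁ v₂) 4∣sum)
      (halve (a₁-a₂≡2·antiSelfDual v₁ v₂) 4∣difference))
    where
    2∤1 : ¬ (+ 2 ∣ + 1)
    2∤1 2∣1 with () ← ℕD.∣1⇒≡1 2∣1
    halve : ∀ {u w} → u ≡ (+ 2) ·³ w → (+ 4) ∣³ u → (+ 2) ∣³ w
    halve {w = w} refl = *-cancelˡ-∣³ (+ 2) {+ 2} {w}
  a₁≡₂a₂ : A₁ ≡₂ A₂
  a₁≡₂a₂ = subst ((+ 2) ∣³_) (sym (a₁-a₂≡2·antiSelfDual v₁ v₂)) (n∣³n·³w (+ 2) (antiSelfDual v₁ v₂))
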